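{- For every integer $m\ge3$ there is a subgroup $G\subset\mathrm{Sp}_{2m}(\mathbb{F}_2)$ such that: (a) there is no quadratic form of Arf invariant $0$ with polar form $\langle\,,\rangle$ fixed by all elements of $G$; and (b) for each $g\in G$ there is a quadratic form of Arf invariant $0$ with polar form $\langle\,,\rangle$ fixed by $g$.
   Context: $\langle\,,\rangle$ is the standard alternating form on $\mathbb{F}_2^{\oplus 2m}$ (basis $e_1,\dots,e_m,f_1,\dots,f_m$ with $\langle e_i,e_j\rangle=\langle f_i,f_j\rangle=0$, $\langle e_i,f_j\rangle=\langle f_j,e_i\rangle=\delta_{ij}$), and $\mathrm{Sp}_{2m}(\mathbb{F}_2)$ its automorphism group. A quadratic form with polar form $\langle\,,\rangle$ is $Q\colon\mathbb{F}_2^{\oplus 2m}\to\mathbb{F}_2$ with $Q(x+y)-Q(x)-Q(y)=\langle x,y\rangle$; $\mathrm{Sp}_{2m}(\mathbb{F}_2)$ acts by $(g\cdot Q)(x)=Q(g^{ -1}x)$. The Arf invariant of $Q$ is $\sum_{i=1}^m Q(e_i)Q(f_i)$ (equivalently, it is $a$ iff exactly $2^{m-1}(2^m+1)$ vectors satisfy $Q(x)=a$). -}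

module Defs where

open import Data.Bool using (Bool; true; false; _xor_; _∧_)
open import Data.Nat using (ℕ; _+_)
open import Data.Fin using (Fin; _↑ˡ_; _↑ʳ_)
import Data.Fin as Fin
open import Data.Vec using (Vec; zipWith; lookup; tabulate; foldr)
open import Relation.Binary.PropositionalEquality using (_≡_)
open import Relation.Nullary.Decidable using (⌊_⌋)

-- F₂ is Bool, with _xor_ as addition and _∧_ as multiplication.
-- F₂^{⊕2m} is Vec Bool (m + m); coordinate (i ↑ˡ m) is the e_i-coordinate
-- and (m ↑ʳ i) is the f_i-coordinate (i : Fin m).
V : ℕ → Set
V m = Vec Bool (m + m)

Σ₂ : ∀ {k} → Vec Bool k → Bool
Σ₂ = foldr _ _xor_ false

_⊕_ : ∀ {n} → Vec Bool n → Vec Bool n → Vec Bool n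
_⊕_ = zipWith _xor_

unit : ∀ {n} → Fin n → Vec Bool n
unit i = tabulate (λ j → ⌊ i Fin.≟ j ⌋)

e : ∀ {m} → Fin m → V m
e {m} i = unit (i ↑ˡ m)

f : ∀ {m} → Fin m → V m
f {m} i = unit (m ↑ʳ i)

⟪_,_⟫ : ∀ {m} → V m → V m → Bool
⟪_,_⟫ {m} x y = Σ₂ (tabulate {n = m} λ i →
  (lookup x (i ↑ˡ m) ∧ lookup y (m ↑ʳ i)) xor (lookup x (m ↑ʳ i) ∧ lookup y (i ↑ˡ m)))

-- (2m)×(2m) matrices over F₂ (rows), acting on column vectors
Mat : ℕ → Set
Mat m = Vec (Vec Bool (m + m)) (m + m)

dot : ∀ {n} → Vec Bool n → Vec Bool n → Bool
dot u v = Σ₂ (zipWith _∧_ u v)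

_·_ : ∀ {m} → Mat m → V m → V m
A · x = Data.Vec.map (λ row → dot row x) A

_⊗_ : ∀ {m} → Mat m → Mat m → Mat m
A ⊗ B = Data.Vec.map (λ row → tabulate (λ j → dot row (Data.Vec.map (λ r → lookup r j) B))) A

I : ∀ {m} → Mat m
I = tabulate unit

record IsSp {m : ℕ} (g : Mat m) : Set where
  field
    inverse : Mat m
    invˡ    : _⊗_ {m} inverse g ≡ I {m}
    invʳ    : _⊗_ {m} g inverse ≡ I {m}
    preserves : ∀ x y → ⟪_,_⟫ {m} (_·_ {m} g x) (_·_ {m} g y) ≡ ⟪_,_⟫ {m} x y

record IsSubgroupOfSp {m : ℕ} (G : Mat m → Set) : Set where
  field
    ⊆Sp   : ∀ g → G g → IsSp {m} g
    has-I : G (I {m})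
    ⊗-closed : ∀ g h → G g → G h → G (_⊗_ {m} g h)
    inv-closed : ∀ g h → G g → _⊗_ {m} h g ≡ I {m} → G h

IsQuadratic : ∀ {m} → (V m → Bool) → Set
IsQuadratic {m} Q = ∀ x y → Q (x ⊕ y) ≡ (Q x xor Q y) xor ⟪_,_⟫ {m} x y

Arf : ∀ {m} → (V m → Bool) → Bool
Arf {m} Q = Σ₂ (tabulate {n = m} λ i → Q (e i) ∧ Q (f i))

-- g fixes Q under the action (g·Q)(x) = Q(g⁻¹ x):
-- for the (unique, if g is invertible) inverse h of g, Q(h x) = Q(x) for all x.
Fixes : ∀ {m} → Mat m → (V m → Bool) → Set
Fixes {m} g Q = ∀ h → _⊗_ {m} h g ≡ I {m} → ∀ x → Q (_·_ {m} h x) ≡ Q x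

module Submission where

-- Write vectors of F₂^{2m} as pairs (x_E, x_F) of their
-- e- and f-coordinates.  For an m×m matrix S over F₂ the shear
--   shear S (x_E, x_F) = (x_E + S x_F, x_F)
-- is linear, satisfies shear S ∘ shear S' = shear (S + S') and hence is an
-- involution, and preserves ⟨,⟩ whenever S is symmetric.  So for every
-- additive group W of symmetric matrices the matrices of the shears by
-- elements of W form a subgroup of Sp_{2m}(F₂).
-- Fixed forms: Q_ℓ(x) = x_E·x_F + ℓ·x_E is quadratic with polar form ⟨,⟩
-- and Arf invariant 0, and it is fixed by shear S as soon as S ℓ = diag S
-- (because x_Fᵀ S x_F = diag S · x_F in characteristic 2).  Conversely a
-- quadratic form Q fixed by shear S satisfies Q(Σᵢ S_ij eᵢ) = S_jj.
-- The theorem takes W = {K a b} with K a b = [[a+b, b],[b, a]] ⊕ 0, a Klein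
-- four-group: each K a b fixes Q_ℓ for ℓ = (a, a+b, 0, …), but a form fixed
-- by K 1 0 and K 0 1 would have Q(e₀) = Q(e₁) = Q(e₀+e₁) = 1, impossible
-- since e₀ ⊥ e₁.  (The construction only needs m ≥ 2.)
-- The file develops: Boolean identities, sums over F₂, symmetric matrices,
-- 2m×2m matrices, coordinates and shears, quadratic forms, the example.

open import Defs
open import Data.Bool using (Bool; true; false; _xor_; _∧_; T)
open import Data.Bool.Properties using (T-∧; xor-identityʳ; xor-assoc; xor-same; ∧-comm; ∧-assoc; ∧-zeroʳ; ∧-distribʳ-xor; ∧-idem)
import Data.Bool.Properties as Bool
open import Data.Nat using (ℕ; zero; suc; _+_; _≤_; s≤s; z≤n)
open import Data.Fin using (Fin; zero; suc; _↑ˡ_; _↑ʳ_; splitAt)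
open import Data.Fin.Properties using (_≟_; splitAt-↑ˡ; splitAt-↑ʳ; join-splitAt)
open import Data.Sum using (inj₁; inj₂)
open import Data.Vec using (Vec; []; _∷_; lookup; tabulate; map; _++_)
open import Data.Vec.Properties using (lookup∘tabulate; tabulate∘lookup; tabulate-cong; tabulate-∘; lookup-map; lookup-zipWith; lookup-++ˡ; lookup-++ʳ; map-∘; map-cong)
open import Data.Product using (Σ; _×_; _,_; proj₁; proj₂)
open import Data.Empty using (⊥-elim)
open import Function using (_∘_)
open import Function.Bundles using (Equivalence)
open import Relation.Binary.PropositionalEquality using (_≡_; _≢_; refl; sym; trans; cong; cong₂; module ≡-Reasoning)
open import Relation.Nullary using (¬_; yes; no)
open import Relation.Nullary.Decidable using (⌊_⌋; toWitness)

open ≡-Reasoning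

infixr 9 _*ᵥ_
infixr 8 _+ᵥ_
infix  7 _∙_

-- Boolean identities are checked by truth tables: an n-ary Boolean
-- operation is a curried function, and two of them are equal iff they
-- agree on all 2ⁿ inputs.
Op : ℕ → Set
Op zero    = Bool
Op (suc n) = Bool → Op n

_≋_ : ∀ {n} → Op n → Op n → Set
_≋_ {zero}  p q = p ≡ q
_≋_ {suc n} F H = ∀ b → F b ≋ H b

agree : ∀ n → Op n → Op n → Bool
agree zero    p q = ⌊ p Bool.≟ q ⌋
agree (suc n) F H = agree n (F false) (H false) ∧ agree n (F true) (H true)

truth-table : ∀ n (F H : Op n) → T (agree n F H) → F ≋ H
truth-table zero    p q ok       = toWitness ok
truth-table (suc n) F H ok false = truth-table n (F false) (H false) (proj₁ (Equivalence.to T-∧ ok))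
truth-table (suc n) F H ok true  = truth-table n (F true) (H true) (proj₂ (Equivalence.to T-∧ ok))

xor-interchange : ∀ a b c d → (a xor b) xor (c xor d) ≡ (a xor c) xor (b xor d)
xor-interchange = truth-table 4 (λ a b c d → (a xor b) xor (c xor d)) (λ a b c d → (a xor c) xor (b xor d)) _

xor-cancel-common : ∀ a b c → (a xor c) xor (b xor c) ≡ a xor b
xor-cancel-common = truth-table 3 (λ a b c → (a xor c) xor (b xor c)) (λ a b c → a xor b) _

∧-regroup : ∀ s a b → (s ∧ a) ∧ b ≡ a ∧ (s ∧ b)
∧-regroup = truth-table 3 (λ s a b → (s ∧ a) ∧ b) (λ s a b → a ∧ (s ∧ b)) _

-- the cross terms t·s and s·t of a symmetric product cancel
cross-terms-cancel : ∀ a t s d → (a xor t ∧ s) xor ((s ∧ t) xor d) ≡ a xor d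
cross-terms-cancel = truth-table 4 (λ a t s d → (a xor t ∧ s) xor ((s ∧ t) xor d)) (λ a t s d → a xor d) _

xor-solve : ∀ p q r → p ≡ (p xor q) xor r → q ≡ r
xor-solve p q r h = begin
  q                              ≡⟨ truth-table 3 (λ p q r → q) (λ p q r → (p xor ((p xor q) xor r)) xor r) _ p q r ⟩
  (p xor ((p xor q) xor r)) xor r ≡⟨ cong (λ t → (p xor t) xor r) (sym h) ⟩
  (p xor p) xor r                 ≡⟨ cong (_xor r) (xor-same p) ⟩
  r                               ∎

∑ : ∀ {n} → (Fin n → Bool) → Bool
∑ g = Σ₂ (tabulate g)

∑-zero : ∀ {n} (g : Fin n → Bool) → (∀ i → g i ≡ false) → ∑ g ≡ false
∑-zero {zero}  g _   = refl
∑-zero {suc n} g g≡0 = cong₂ _xor_ (g≡0 zero) (∑-zero (g ∘ suc) (g≡0 ∘ suc))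

∑-cong : ∀ {n} {g h : Fin n → Bool} → (∀ i → g i ≡ h i) → ∑ g ≡ ∑ h
∑-cong g≗h = cong Σ₂ (tabulate-cong g≗h)

∑-xor : ∀ {n} (g h : Fin n → Bool) → ∑ (λ i → g i xor h i) ≡ ∑ g xor ∑ h
∑-xor {zero}  g h = refl
∑-xor {suc n} g h =
  trans (cong ((g zero xor h zero) xor_) (∑-xor (g ∘ suc) (h ∘ suc))) (xor-interchange (g zero) (h zero) (∑ (g ∘ suc)) (∑ (h ∘ suc)))

∑-scaleˡ : ∀ {n} s (g : Fin n → Bool) → ∑ (λ i → s ∧ g i) ≡ s ∧ ∑ g
∑-scaleˡ true  g = refl
∑-scaleˡ false g = ∑-zero (λ i → false ∧ g i) (λ _ → refl)

∑-scaleʳ : ∀ {n} s (g : Fin n → Bool) → ∑ (λ i → g i ∧ s) ≡ ∑ g ∧ s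
∑-scaleʳ s g = trans (∑-cong (λ i → ∧-comm (g i) s)) (trans (∑-scaleˡ s g) (∧-comm s (∑ g)))

∑-swap : ∀ {m n} (g : Fin m → Fin n → Bool) → ∑ (λ i → ∑ (g i)) ≡ ∑ (λ j → ∑ (λ i → g i j))
∑-swap {zero}  g = sym (∑-zero (λ j → ∑ (λ i → g i j)) (λ _ → refl))
∑-swap {suc m} g =
  trans (cong (∑ (g zero) xor_) (∑-swap (g ∘ suc))) (sym (∑-xor (g zero) (λ j → ∑ (λ i → g (suc i) j))))

∑-++ : ∀ m {n} (g : Fin (m + n) → Bool) → ∑ g ≡ ∑ (λ i → g (i ↑ˡ n)) xor ∑ (λ i → g (m ↑ʳ i))
∑-++ zero    g = refl
∑-++ (suc m) g = trans (cong (g zero xor_) (∑-++ m (g ∘ suc))) (sym (xor-assoc (g zero) _ _))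

δ : ∀ {n} → Fin n → Fin n → Bool
δ i j = ⌊ i ≟ j ⌋

δ-suc : ∀ {n} (i j : Fin n) → δ (suc i) (suc j) ≡ δ i j
δ-suc i j with i ≟ j
... | yes _ = refl
... | no  _ = refl

δ-≢ : ∀ {n} {i j : Fin n} → i ≢ j → δ i j ≡ false
δ-≢ {i = i} {j} i≢j with i ≟ j
... | yes i≡j = ⊥-elim (i≢j i≡j)
... | no  _   = refl

∑-δ : ∀ {n} (i : Fin n) (g : Fin n → Bool) → ∑ (λ j → δ i j ∧ g j) ≡ g i
∑-δ zero    g = trans (cong (g zero xor_) (∑-zero (λ j → δ zero (suc j) ∧ g (suc j)) (λ _ → refl))) (xor-identityʳ (g zero))
∑-δ (suc i) g = trans (∑-cong (λ j → cong (_∧ g (suc j)) (δ-suc i j))) (∑-δ i (g ∘ suc))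

0ᵥ : ∀ {n} → Fin n → Bool
0ᵥ _ = false

_+ᵥ_ : ∀ {n} → (Fin n → Bool) → (Fin n → Bool) → Fin n → Bool
(u +ᵥ v) i = u i xor v i

_∙_ : ∀ {n} → (Fin n → Bool) → (Fin n → Bool) → Bool
u ∙ v = ∑ (λ i → u i ∧ v i)

∙-cong : ∀ {n} {u u' v v' : Fin n → Bool} → (∀ i → u i ≡ u' i) → (∀ i → v i ≡ v' i) → u ∙ v ≡ u' ∙ v'
∙-cong u≗u' v≗v' = ∑-cong (λ i → cong₂ _∧_ (u≗u' i) (v≗v' i))

∙-comm : ∀ {n} (u v : Fin n → Bool) → u ∙ v ≡ v ∙ u
∙-comm u v = ∑-cong (λ i → ∧-comm (u i) (v i))

∙-xorˡ : ∀ {n} (u u' v : Fin n → Bool) → (u +ᵥ u') ∙ v ≡ u ∙ v xor u' ∙ v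
∙-xorˡ u u' v = trans (∑-cong (λ i → ∧-distribʳ-xor (v i) (u i) (u' i))) (∑-xor (λ i → u i ∧ v i) (λ i → u' i ∧ v i))

∙-xorʳ : ∀ {n} (u v v' : Fin n → Bool) → u ∙ (v +ᵥ v') ≡ u ∙ v xor u ∙ v'
∙-xorʳ u v v' = trans (∙-comm u _) (trans (∙-xorˡ v v' u) (cong₂ _xor_ (∙-comm v u) (∙-comm v' u)))

∙-zeroˡ : ∀ {n} (v : Fin n → Bool) → 0ᵥ ∙ v ≡ false
∙-zeroˡ v = ∑-zero (λ i → false ∧ v i) (λ _ → refl)

∙-vanishingʳ : ∀ {n} (u v : Fin n → Bool) → (∀ i → v i ≡ false) → u ∙ v ≡ false
∙-vanishingʳ u v v≡0 = ∑-zero (λ i → u i ∧ v i) (λ i → trans (cong (u i ∧_) (v≡0 i)) (∧-zeroʳ (u i)))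

∙-zeroʳ : ∀ {n} (u : Fin n → Bool) → u ∙ 0ᵥ ≡ false
∙-zeroʳ u = ∙-vanishingʳ u 0ᵥ (λ _ → refl)

∙-supported₂ : ∀ {n} (u v : Fin (suc (suc n)) → Bool) → (∀ j → v (suc (suc j)) ≡ false) →
               u ∙ v ≡ u zero ∧ v zero xor u (suc zero) ∧ v (suc zero)
∙-supported₂ u v v-vanishes =
  cong (λ t → u zero ∧ v zero xor t)
       (trans (cong (u (suc zero) ∧ v (suc zero) xor_) (∙-vanishingʳ (λ j → u (suc (suc j))) (λ j → v (suc (suc j))) v-vanishes))
              (xor-identityʳ _))

Block : ℕ → Set
Block n = Fin n → Fin n → Bool

0ᴮ : ∀ {n} → Block n
0ᴮ _ _ = false

_⊞_ : ∀ {n} → Block n → Block n → Block n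
(S ⊞ S') i j = S i j xor S' i j

_*ᵥ_ : ∀ {n} → Block n → (Fin n → Bool) → Fin n → Bool
(S *ᵥ u) i = S i ∙ u

Symmetric : ∀ {n} → Block n → Set
Symmetric S = ∀ i j → S i j ≡ S j i

diag : ∀ {n} → Block n → Fin n → Bool
diag S i = S i i

*ᵥ-congˡ : ∀ {n} {S S' : Block n} {u} → (∀ i j → S i j ≡ S' i j) → ∀ i → (S *ᵥ u) i ≡ (S' *ᵥ u) i
*ᵥ-congˡ S≐S' i = ∙-cong (S≐S' i) (λ _ → refl)

*ᵥ-congʳ : ∀ {n} {S : Block n} {u v} → (∀ i → u i ≡ v i) → ∀ i → (S *ᵥ u) i ≡ (S *ᵥ v) i
*ᵥ-congʳ u≗v i = ∙-cong (λ _ → refl) u≗v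

⊞-*ᵥ : ∀ {n} (S S' : Block n) u i → ((S ⊞ S') *ᵥ u) i ≡ (S *ᵥ u) i xor (S' *ᵥ u) i
⊞-*ᵥ S S' u i = ∙-xorˡ (S i) (S' i) u

*ᵥ-δ : ∀ {n} (S : Block n) j i → (S *ᵥ δ j) i ≡ S i j
*ᵥ-δ S j i = trans (∙-comm (S i) (δ j)) (∑-δ j (S i))

*ᵥ-adjoint : ∀ {n} (S : Block n) → Symmetric S → ∀ u v → (S *ᵥ u) ∙ v ≡ u ∙ (S *ᵥ v)
*ᵥ-adjoint S S-sym u v = begin
  (S *ᵥ u) ∙ v                              ≡⟨ ∑-cong (λ i → sym (∑-scaleʳ (v i) (λ j → S i j ∧ u j))) ⟩
  ∑ (λ i → ∑ (λ j → (S i j ∧ u j) ∧ v i))   ≡⟨ ∑-swap (λ i j → (S i j ∧ u j) ∧ v i) ⟩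
  ∑ (λ j → ∑ (λ i → (S i j ∧ u j) ∧ v i))   ≡⟨ ∑-cong (λ j → ∑-cong (λ i → regroup i j)) ⟩
  ∑ (λ j → ∑ (λ i → u j ∧ (S j i ∧ v i)))   ≡⟨ ∑-cong (λ j → ∑-scaleˡ (u j) (λ i → S j i ∧ v i)) ⟩
  u ∙ (S *ᵥ v)                              ∎
  where
  regroup : ∀ i j → (S i j ∧ u j) ∧ v i ≡ u j ∧ (S j i ∧ v i)
  regroup i j = trans (cong (λ s → (s ∧ u j) ∧ v i) (S-sym i j))
    (∧-regroup (S j i) (u j) (v i))

-- In characteristic 2 the quadratic form uᵀ S u of a symmetric S is
-- linear: the off-diagonal terms S_ij u_i u_j + S_ji u_j u_i cancel.
*ᵥ-diag : ∀ {n} (S : Block n) → Symmetric S → ∀ u → (S *ᵥ u) ∙ u ≡ diag S ∙ u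
*ᵥ-diag {zero}  S S-sym u = refl
*ᵥ-diag {suc n} S S-sym u = begin
  ((s₀ ∧ u₀) xor r ∙ u') ∧ u₀ xor ∑ (λ i → ((S (suc i) zero ∧ u₀) xor (S' *ᵥ u') i) ∧ u' i)
    ≡⟨ cong (((s₀ ∧ u₀) xor r ∙ u') ∧ u₀ xor_) rest ⟩
  ((s₀ ∧ u₀) xor r ∙ u') ∧ u₀ xor ((u₀ ∧ r ∙ u') xor diag S' ∙ u')
    ≡⟨ cong (_xor ((u₀ ∧ r ∙ u') xor diag S' ∙ u')) (trans (∧-distribʳ-xor u₀ (s₀ ∧ u₀) (r ∙ u')) (cong (_xor (r ∙ u' ∧ u₀)) (absorb s₀ u₀))) ⟩
  ((s₀ ∧ u₀) xor r ∙ u' ∧ u₀) xor ((u₀ ∧ r ∙ u') xor diag S' ∙ u')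
    ≡⟨ cross-terms-cancel (s₀ ∧ u₀) (r ∙ u') u₀ (diag S' ∙ u') ⟩
  (s₀ ∧ u₀) xor diag S' ∙ u'
    ∎
  where
  s₀ = S zero zero
  u₀ = u zero
  u' = u ∘ suc
  r : Fin n → Bool
  r j = S zero (suc j)
  S' : Block n
  S' i j = S (suc i) (suc j)

  absorb : ∀ s a → (s ∧ a) ∧ a ≡ s ∧ a
  absorb s a = trans (∧-assoc s a a) (cong (s ∧_) (∧-idem a))

  rest : ∑ (λ i → ((S (suc i) zero ∧ u₀) xor (S' *ᵥ u') i) ∧ u' i) ≡ (u₀ ∧ r ∙ u') xor diag S' ∙ u'
  rest = begin
    ∑ (λ i → ((S (suc i) zero ∧ u₀) xor (S' *ᵥ u') i) ∧ u' i)
      ≡⟨ ∑-cong (λ i → ∧-distribʳ-xor (u' i) (S (suc i) zero ∧ u₀) ((S' *ᵥ u') i)) ⟩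
    ∑ (λ i → ((S (suc i) zero ∧ u₀) ∧ u' i) xor ((S' *ᵥ u') i ∧ u' i))
      ≡⟨ ∑-xor (λ i → (S (suc i) zero ∧ u₀) ∧ u' i) (λ i → (S' *ᵥ u') i ∧ u' i) ⟩
    ∑ (λ i → (S (suc i) zero ∧ u₀) ∧ u' i) xor (S' *ᵥ u') ∙ u'
      ≡⟨ cong₂ _xor_ column₀ (*ᵥ-diag S' (λ i j → S-sym (suc i) (suc j)) u') ⟩
    (u₀ ∧ r ∙ u') xor diag S' ∙ u'
      ∎
    where
    column₀ : ∑ (λ i → (S (suc i) zero ∧ u₀) ∧ u' i) ≡ u₀ ∧ r ∙ u'
    column₀ = trans
      (∑-cong (λ i → trans (cong (λ s → (s ∧ u₀) ∧ u' i) (S-sym (suc i) zero))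
                           (∧-regroup (r i) u₀ (u' i))))
      (∑-scaleˡ u₀ (λ i → r i ∧ u' i))

vec-ext : ∀ {A : Set} {n} {x y : Vec A n} → (∀ i → lookup x i ≡ lookup y i) → x ≡ y
vec-ext {x = x} {y} x≗y = trans (sym (tabulate∘lookup x)) (trans (tabulate-cong x≗y) (tabulate∘lookup y))

dot-tabulate : ∀ {n} (g : Fin n → Bool) (x : Vec Bool n) → dot (tabulate g) x ≡ g ∙ lookup x
dot-tabulate {zero}  g []      = refl
dot-tabulate {suc n} g (a ∷ x) = cong ((g zero ∧ a) xor_) (dot-tabulate (g ∘ suc) x)

dot-lookup : ∀ {n} (u x : Vec Bool n) → dot u x ≡ lookup u ∙ lookup x
dot-lookup u x = trans (cong (λ w → dot w x) (sym (tabulate∘lookup u))) (dot-tabulate (lookup u) x)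

dot-map : ∀ {A : Set} {k} (r : Vec Bool k) (h : A → Bool) (B : Vec A k) →
          dot r (map h B) ≡ ∑ (λ l → lookup r l ∧ h (lookup B l))
dot-map r h B = trans (dot-lookup r (map h B)) (∑-cong (λ l → cong (lookup r l ∧_) (lookup-map l h B)))

dot-unitˡ : ∀ {n} (i : Fin n) (x : Vec Bool n) → dot (unit i) x ≡ lookup x i
dot-unitˡ i x = trans (dot-tabulate (δ i) x) (∑-δ i (lookup x))

dot-unitʳ : ∀ {n} (r : Vec Bool n) (j : Fin n) → dot r (unit j) ≡ lookup r j
dot-unitʳ r j = trans (dot-lookup r (unit j))
  (trans (∙-cong (λ _ → refl) (lookup∘tabulate (δ j))) (trans (∙-comm (lookup r) (δ j)) (∑-δ j (lookup r))))

dot-assoc : ∀ {k n} (r : Vec Bool k) (B : Vec (Vec Bool n) k) (x : Vec Bool n) →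
            dot (tabulate (λ j → dot r (map (λ b → lookup b j) B))) x ≡ dot r (map (λ b → dot b x) B)
dot-assoc r B x = begin
  dot (tabulate (λ j → dot r (map (λ b → lookup b j) B))) x
    ≡⟨ dot-tabulate _ x ⟩
  ∑ (λ j → dot r (map (λ b → lookup b j) B) ∧ xⱼ j)
    ≡⟨ ∑-cong (λ j → cong (_∧ xⱼ j) (dot-map r (λ b → lookup b j) B)) ⟩
  ∑ (λ j → ∑ (λ l → rₗ l ∧ Bₗⱼ l j) ∧ xⱼ j)
    ≡⟨ ∑-cong (λ j → sym (∑-scaleʳ (xⱼ j) (λ l → rₗ l ∧ Bₗⱼ l j))) ⟩
  ∑ (λ j → ∑ (λ l → (rₗ l ∧ Bₗⱼ l j) ∧ xⱼ j))
    ≡⟨ ∑-swap (λ j l → (rₗ l ∧ Bₗⱼ l j) ∧ xⱼ j) ⟩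
  ∑ (λ l → ∑ (λ j → (rₗ l ∧ Bₗⱼ l j) ∧ xⱼ j))
    ≡⟨ ∑-cong (λ l → trans (∑-cong (λ j → ∧-assoc (rₗ l) (Bₗⱼ l j) (xⱼ j))) (∑-scaleˡ (rₗ l) (λ j → Bₗⱼ l j ∧ xⱼ j))) ⟩
  ∑ (λ l → rₗ l ∧ (lookup (lookup B l) ∙ xⱼ))
    ≡⟨ ∑-cong (λ l → cong (rₗ l ∧_) (sym (dot-lookup (lookup B l) x))) ⟩
  ∑ (λ l → rₗ l ∧ dot (lookup B l) x)
    ≡⟨ sym (dot-map r (λ b → dot b x) B) ⟩
  dot r (map (λ b → dot b x) B)
    ∎
  where
  rₗ = lookup r
  xⱼ = lookup x
  Bₗⱼ : _ → _ → Bool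
  Bₗⱼ l j = lookup (lookup B l) j

module Symplectic (m : ℕ) where

  _·ₘ_ : Mat m → V m → V m
  A ·ₘ x = _·_ {m} A x

  _⊗ₘ_ : Mat m → Mat m → Mat m
  A ⊗ₘ B = _⊗_ {m} A B

  Iₘ : Mat m
  Iₘ = I {m}

  ⟪_,_⟫ₘ : V m → V m → Bool
  ⟪ x , y ⟫ₘ = ⟪_,_⟫ {m} x y

  ⊗-action : ∀ A B x → (A ⊗ₘ B) ·ₘ x ≡ A ·ₘ (B ·ₘ x)
  ⊗-action A B x = trans (sym (map-∘ _ _ A)) (map-cong (λ r → dot-assoc r B x) A)

  I-action : ∀ x → Iₘ ·ₘ x ≡ x
  I-action x = trans (sym (tabulate-∘ _ unit)) (trans (tabulate-cong (λ i → dot-unitˡ i x)) (tabulate∘lookup x))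

  mat-ext : ∀ A B → (∀ x → A ·ₘ x ≡ B ·ₘ x) → A ≡ B
  mat-ext A B A≗B = vec-ext λ i → vec-ext λ j →
    trans (entry A i j) (trans (cong (λ y → lookup y i) (A≗B (unit j))) (sym (entry B i j)))
    where
    entry : ∀ C i j → lookup (lookup C i) j ≡ lookup (C ·ₘ unit j) i
    entry C i j = sym (trans (lookup-map i _ C) (dot-unitʳ (lookup C i) j))

  infix 10 _ᴱ _ᶠ

  _ᴱ : V m → Fin m → Bool
  (x ᴱ) i = lookup x (i ↑ˡ m)

  _ᶠ : V m → Fin m → Bool
  (x ᶠ) i = lookup x (m ↑ʳ i)

  pair : ∀ {A : Set} → (Fin m → A) → (Fin m → A) → Vec A (m + m)
  pair u v = tabulate u ++ tabulate v

  pair-ᴱ : ∀ {A : Set} (u v : Fin m → A) i → lookup (pair u v) (i ↑ˡ m) ≡ u i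
  pair-ᴱ u v i = trans (lookup-++ˡ (tabulate u) (tabulate v) i) (lookup∘tabulate u i)

  pair-ᶠ : ∀ {A : Set} (u v : Fin m → A) i → lookup (pair u v) (m ↑ʳ i) ≡ v i
  pair-ᶠ u v i = trans (lookup-++ʳ (tabulate u) (tabulate v) i) (lookup∘tabulate v i)

  pair-cong : ∀ {A : Set} {u u' v v' : Fin m → A} → (∀ i → u i ≡ u' i) → (∀ i → v i ≡ v' i) → pair u v ≡ pair u' v'
  pair-cong u≗u' v≗v' = cong₂ _++_ (tabulate-cong u≗u') (tabulate-cong v≗v')

  V-ext : ∀ {x y : V m} → (∀ i → (x ᴱ) i ≡ (y ᴱ) i) → (∀ i → (x ᶠ) i ≡ (y ᶠ) i) → x ≡ y
  V-ext {x} {y} x≗yᴱ x≗yᶠ = vec-ext coordinate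
    where
    coordinate : ∀ p → lookup x p ≡ lookup y p
    coordinate p with splitAt m p | join-splitAt m m p
    ... | inj₁ i | refl = x≗yᴱ i
    ... | inj₂ i | refl = x≗yᶠ i

  ⊕-ᴱ : ∀ x y i → ((x ⊕ y) ᴱ) i ≡ (x ᴱ +ᵥ y ᴱ) i
  ⊕-ᴱ x y i = lookup-zipWith _xor_ (i ↑ˡ m) x y

  ⊕-ᶠ : ∀ x y i → ((x ⊕ y) ᶠ) i ≡ (x ᶠ +ᵥ y ᶠ) i
  ⊕-ᶠ x y i = lookup-zipWith _xor_ (m ↑ʳ i) x y

  ⟪⟫-coordinates : ∀ x y → ⟪ x , y ⟫ₘ ≡ x ᴱ ∙ y ᶠ xor x ᶠ ∙ y ᴱ
  ⟪⟫-coordinates x y = ∑-xor (λ i → (x ᴱ) i ∧ (y ᶠ) i) (λ i → (x ᶠ) i ∧ (y ᴱ) i)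

  Eᵥ : (Fin m → Bool) → V m
  Eᵥ u = pair u 0ᵥ

  Fᵥ : (Fin m → Bool) → V m
  Fᵥ v = pair 0ᵥ v

  Eᵥ-+ᵥ : ∀ u v → Eᵥ (u +ᵥ v) ≡ Eᵥ u ⊕ Eᵥ v
  Eᵥ-+ᵥ u v = V-ext
    (λ i → trans (pair-ᴱ _ 0ᵥ i) (sym (trans (⊕-ᴱ (Eᵥ u) (Eᵥ v) i) (cong₂ _xor_ (pair-ᴱ u 0ᵥ i) (pair-ᴱ v 0ᵥ i)))))
    (λ i → trans (pair-ᶠ _ 0ᵥ i) (sym (trans (⊕-ᶠ (Eᵥ u) (Eᵥ v) i) (cong₂ _xor_ (pair-ᶠ u 0ᵥ i) (pair-ᶠ v 0ᵥ i)))))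

  ⟪Eᵥ,Eᵥ⟫ : ∀ u v → ⟪ Eᵥ u , Eᵥ v ⟫ₘ ≡ false
  ⟪Eᵥ,Eᵥ⟫ u v = trans (⟪⟫-coordinates (Eᵥ u) (Eᵥ v)) (cong₂ _xor_
    (trans (∙-cong (pair-ᴱ u 0ᵥ) (pair-ᶠ v 0ᵥ)) (∙-zeroʳ u))
    (trans (∙-cong (pair-ᶠ u 0ᵥ) (pair-ᴱ v 0ᵥ)) (∙-zeroˡ v)))

  ↑ʳ≢↑ˡ : ∀ (i j : Fin m) → m ↑ʳ i ≢ j ↑ˡ m
  ↑ʳ≢↑ˡ i j eq with trans (sym (splitAt-↑ʳ m m i)) (trans (cong (splitAt m) eq) (splitAt-↑ˡ m j m))
  ... | ()

  fᴱ-zero : ∀ i j → ((f {m} i) ᴱ) j ≡ false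
  fᴱ-zero i j = trans (lookup∘tabulate (δ (m ↑ʳ i)) (j ↑ˡ m)) (δ-≢ (↑ʳ≢↑ˡ i j))

  shear : Block m → V m → V m
  shear S x = pair (x ᴱ +ᵥ S *ᵥ x ᶠ) (x ᶠ)

  shear-ᴱ : ∀ S x i → ((shear S x) ᴱ) i ≡ (x ᴱ +ᵥ S *ᵥ x ᶠ) i
  shear-ᴱ S x = pair-ᴱ _ _

  shear-ᶠ : ∀ S x i → ((shear S x) ᶠ) i ≡ (x ᶠ) i
  shear-ᶠ S x = pair-ᶠ _ _

  shear-congˡ : ∀ {S S'} → (∀ i j → S i j ≡ S' i j) → ∀ x → shear S x ≡ shear S' x
  shear-congˡ S≐S' x = pair-cong (λ i → cong ((x ᴱ) i xor_) (*ᵥ-congˡ S≐S' i)) (λ _ → refl)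

  shear-as-sum : ∀ S x → shear S x ≡ x ⊕ Eᵥ (S *ᵥ x ᶠ)
  shear-as-sum S x = V-ext
    (λ i → trans (shear-ᴱ S x i) (sym (trans (⊕-ᴱ x _ i) (cong ((x ᴱ) i xor_) (pair-ᴱ _ 0ᵥ i)))))
    (λ i → trans (shear-ᶠ S x i) (sym (trans (⊕-ᶠ x _ i) (trans (cong ((x ᶠ) i xor_) (pair-ᶠ _ 0ᵥ i)) (xor-identityʳ _)))))

  shear-zero : ∀ x → shear 0ᴮ x ≡ x
  shear-zero x = V-ext
    (λ i → trans (shear-ᴱ 0ᴮ x i) (trans (cong ((x ᴱ) i xor_) (∙-zeroˡ (x ᶠ))) (xor-identityʳ _)))
    (shear-ᶠ 0ᴮ x)

  shear-∘ : ∀ S S' x → shear S (shear S' x) ≡ shear (S ⊞ S') x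
  shear-∘ S S' x = V-ext onᴱ (λ i → trans (shear-ᶠ S (shear S' x) i) (trans (shear-ᶠ S' x i) (sym (shear-ᶠ (S ⊞ S') x i))))
    where
    onᴱ : ∀ i → ((shear S (shear S' x)) ᴱ) i ≡ ((shear (S ⊞ S') x) ᴱ) i
    onᴱ i = begin
      ((shear S (shear S' x)) ᴱ) i
        ≡⟨ shear-ᴱ S (shear S' x) i ⟩
      ((shear S' x) ᴱ) i xor (S *ᵥ (shear S' x) ᶠ) i
        ≡⟨ cong₂ _xor_ (shear-ᴱ S' x i) (*ᵥ-congʳ {S = S} (shear-ᶠ S' x) i) ⟩
      ((x ᴱ) i xor (S' *ᵥ x ᶠ) i) xor (S *ᵥ x ᶠ) i
        ≡⟨ truth-table 3 (λ a b c → (a xor b) xor c) (λ a b c → a xor (c xor b)) _ ((x ᴱ) i) ((S' *ᵥ x ᶠ) i) ((S *ᵥ x ᶠ) i) ⟩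
      (x ᴱ) i xor ((S *ᵥ x ᶠ) i xor (S' *ᵥ x ᶠ) i)
        ≡⟨ cong ((x ᴱ) i xor_) (sym (⊞-*ᵥ S S' (x ᶠ) i)) ⟩
      (x ᴱ) i xor ((S ⊞ S') *ᵥ x ᶠ) i
        ≡⟨ sym (shear-ᴱ (S ⊞ S') x i) ⟩
      ((shear (S ⊞ S') x) ᴱ) i
        ∎

  shear-involutive : ∀ S x → shear S (shear S x) ≡ x
  shear-involutive S x =
    trans (shear-∘ S S x) (trans (shear-congˡ (λ i j → xor-same (S i j)) x) (shear-zero x))

  shear-preserves : ∀ {S} → Symmetric S → ∀ x y → ⟪ shear S x , shear S y ⟫ₘ ≡ ⟪ x , y ⟫ₘ
  shear-preserves {S} S-sym x y = begin
    ⟪ shear S x , shear S y ⟫ₘ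
      ≡⟨ ⟪⟫-coordinates (shear S x) (shear S y) ⟩
    (shear S x) ᴱ ∙ (shear S y) ᶠ xor (shear S x) ᶠ ∙ (shear S y) ᴱ
      ≡⟨ cong₂ _xor_ (∙-cong (shear-ᴱ S x) (shear-ᶠ S y)) (∙-cong (shear-ᶠ S x) (shear-ᴱ S y)) ⟩
    (x ᴱ +ᵥ S *ᵥ x ᶠ) ∙ y ᶠ xor x ᶠ ∙ (y ᴱ +ᵥ S *ᵥ y ᶠ)
      ≡⟨ cong₂ _xor_ (∙-xorˡ (x ᴱ) _ (y ᶠ)) (∙-xorʳ (x ᶠ) (y ᴱ) _) ⟩
    (x ᴱ ∙ y ᶠ xor (S *ᵥ x ᶠ) ∙ y ᶠ) xor (x ᶠ ∙ y ᴱ xor x ᶠ ∙ (S *ᵥ y ᶠ))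
      ≡⟨ cong (λ t → (x ᴱ ∙ y ᶠ xor t) xor (x ᶠ ∙ y ᴱ xor x ᶠ ∙ (S *ᵥ y ᶠ))) (*ᵥ-adjoint S S-sym (x ᶠ) (y ᶠ)) ⟩
    (x ᴱ ∙ y ᶠ xor x ᶠ ∙ (S *ᵥ y ᶠ)) xor (x ᶠ ∙ y ᴱ xor x ᶠ ∙ (S *ᵥ y ᶠ))
      ≡⟨ xor-cancel-common (x ᴱ ∙ y ᶠ) (x ᶠ ∙ y ᴱ) (x ᶠ ∙ (S *ᵥ y ᶠ)) ⟩
    x ᴱ ∙ y ᶠ xor x ᶠ ∙ y ᴱ
      ≡⟨ sym (⟪⟫-coordinates x y) ⟩
    ⟪ x , y ⟫ₘ
      ∎

  shearMatrix : Block m → Mat m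
  shearMatrix S = pair (λ i → pair (δ i) (S i)) (λ i → pair 0ᵥ (δ i))

  dot-pair : ∀ u v x → dot (pair u v) x ≡ u ∙ x ᴱ xor v ∙ x ᶠ
  dot-pair u v x = trans (dot-lookup (pair u v) x) (trans (∑-++ m _) (cong₂ _xor_
    (∑-cong (λ i → cong (_∧ (x ᴱ) i) (pair-ᴱ u v i)))
    (∑-cong (λ i → cong (_∧ (x ᶠ) i) (pair-ᶠ u v i)))))

  shearMatrix-action : ∀ S x → shearMatrix S ·ₘ x ≡ shear S x
  shearMatrix-action S x = V-ext onᴱ onᶠ
    where
    row : ∀ p → lookup (shearMatrix S ·ₘ x) p ≡ dot (lookup (shearMatrix S) p) x
    row p = lookup-map p _ (shearMatrix S)

    onᴱ : ∀ i → ((shearMatrix S ·ₘ x) ᴱ) i ≡ ((shear S x) ᴱ) i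
    onᴱ i = begin
      lookup (shearMatrix S ·ₘ x) (i ↑ˡ m) ≡⟨ row (i ↑ˡ m) ⟩
      dot (lookup (shearMatrix S) (i ↑ˡ m)) x ≡⟨ cong (λ r → dot r x) (pair-ᴱ _ _ i) ⟩
      dot (pair (δ i) (S i)) x               ≡⟨ dot-pair (δ i) (S i) x ⟩
      δ i ∙ x ᴱ xor S i ∙ x ᶠ                ≡⟨ cong (_xor (S *ᵥ x ᶠ) i) (∑-δ i (x ᴱ)) ⟩
      (x ᴱ) i xor (S *ᵥ x ᶠ) i               ≡⟨ sym (shear-ᴱ S x i) ⟩
      ((shear S x) ᴱ) i                      ∎

    onᶠ : ∀ i → ((shearMatrix S ·ₘ x) ᶠ) i ≡ ((shear S x) ᶠ) i
    onᶠ i = begin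
      lookup (shearMatrix S ·ₘ x) (m ↑ʳ i) ≡⟨ row (m ↑ʳ i) ⟩
      dot (lookup (shearMatrix S) (m ↑ʳ i)) x ≡⟨ cong (λ r → dot r x) (pair-ᶠ _ _ i) ⟩
      dot (pair 0ᵥ (δ i)) x                  ≡⟨ dot-pair 0ᵥ (δ i) x ⟩
      0ᵥ ∙ x ᴱ xor δ i ∙ x ᶠ                 ≡⟨ cong₂ _xor_ (∙-zeroˡ (x ᴱ)) (∑-δ i (x ᶠ)) ⟩
      (x ᶠ) i                                ≡⟨ sym (shear-ᶠ S x i) ⟩
      ((shear S x) ᶠ) i                      ∎

  record IsShear (S : Block m) (g : Mat m) : Set where
    constructor isShear
    field
      acts : ∀ x → g ·ₘ x ≡ shear S x

  open IsShear

  shearMatrix-IsShear : ∀ S → IsShear S (shearMatrix S)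
  shearMatrix-IsShear S = isShear (shearMatrix-action S)

  IsShear-I : IsShear 0ᴮ Iₘ
  IsShear-I = isShear λ x → trans (I-action x) (sym (shear-zero x))

  IsShear-⊗ : ∀ {S S' g h} → IsShear S g → IsShear S' h → IsShear (S ⊞ S') (g ⊗ₘ h)
  IsShear-⊗ {S} {S'} {g} {h} gS hS' = isShear λ x →
    trans (⊗-action g h x) (trans (cong (g ·ₘ_) (acts hS' x)) (trans (acts gS (shear S' x)) (shear-∘ S S' x)))

  IsShear-square : ∀ {S g} → IsShear S g → g ⊗ₘ g ≡ Iₘ
  IsShear-square {S} {g} gS = mat-ext (g ⊗ₘ g) Iₘ λ x →
    trans (⊗-action g g x) (trans (cong (g ·ₘ_) (acts gS x))
      (trans (acts gS (shear S x)) (trans (shear-involutive S x) (sym (I-action x)))))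

  -- a left inverse of the matrix of an involution acts as the same involution
  IsShear-inverse : ∀ {S g h} → IsShear S g → h ⊗ₘ g ≡ Iₘ → IsShear S h
  IsShear-inverse {S} {g} {h} gS hg≡I = isShear λ x → begin
    h ·ₘ x                 ≡⟨ cong (h ·ₘ_) (sym (trans (acts gS (shear S x)) (shear-involutive S x))) ⟩
    h ·ₘ (g ·ₘ shear S x)  ≡⟨ sym (⊗-action h g (shear S x)) ⟩
    (h ⊗ₘ g) ·ₘ shear S x  ≡⟨ cong (_·ₘ shear S x) hg≡I ⟩
    Iₘ ·ₘ shear S x        ≡⟨ I-action (shear S x) ⟩
    shear S x              ∎

  IsShear-Sp : ∀ {S g} → Symmetric S → IsShear S g → IsSp {m} g
  IsShear-Sp {g = g} S-sym gS = record
    { inverse   = g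
    ; invˡ      = IsShear-square gS
    ; invʳ      = IsShear-square gS
    ; preserves = λ x y → trans (cong₂ ⟪_,_⟫ₘ (acts gS x) (acts gS y)) (shear-preserves S-sym x y)
    }

  record IsSymmetricSubspace (W : Block m → Set) : Set where
    field
      symmetric : ∀ {S} → W S → Symmetric S
      zero∈     : W 0ᴮ
      ⊞-closed  : ∀ {S S'} → W S → W S' → W (S ⊞ S')

  ShearGroup : (Block m → Set) → Mat m → Set
  ShearGroup W g = Σ (Block m) λ S → W S × IsShear S g

  ShearGroup-subgroup : ∀ {W} → IsSymmetricSubspace W → IsSubgroupOfSp {m} (ShearGroup W)
  ShearGroup-subgroup W-subspace = record
    { ⊆Sp        = λ { g (S , S∈W , gS) → IsShear-Sp (symmetric S∈W) gS }
    ; has-I      = 0ᴮ , zero∈ , IsShear-I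
    ; ⊗-closed   = λ { g h (S , S∈W , gS) (S' , S'∈W , hS') → S ⊞ S' , ⊞-closed S∈W S'∈W , IsShear-⊗ gS hS' }
    ; inv-closed = λ { g h (S , S∈W , gS) hg≡I → S , S∈W , IsShear-inverse gS hg≡I }
    }
    where open IsSymmetricSubspace W-subspace

  IsShear-Fixes : ∀ {S g Q} → IsShear S g → (∀ x → Q (shear S x) ≡ Q x) → Fixes {m} g Q
  IsShear-Fixes {Q = Q} gS Q-invariant h hg≡I x = trans (cong Q (acts (IsShear-inverse gS hg≡I) x)) (Q-invariant x)

  Fixes-IsShear : ∀ {S g Q} → IsShear S g → Fixes {m} g Q → ∀ x → Q (shear S x) ≡ Q x
  Fixes-IsShear {g = g} {Q} gS g-fixes x = trans (cong Q (sym (acts gS x))) (g-fixes g (IsShear-square gS) x)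

  -- Q_ℓ(x) = x_E·x_F + ℓ·x_E: the standard form of Arf invariant 0 plus a
  -- linear functional on the e-coordinates.
  Qℓ : (Fin m → Bool) → V m → Bool
  Qℓ ℓ x = x ᴱ ∙ x ᶠ xor ℓ ∙ x ᴱ

  Qℓ-quadratic : ∀ ℓ → IsQuadratic {m} (Qℓ ℓ)
  Qℓ-quadratic ℓ x y = begin
    Qℓ ℓ (x ⊕ y)
      ≡⟨ cong₂ _xor_ (∙-cong (⊕-ᴱ x y) (⊕-ᶠ x y)) (∙-cong (λ _ → refl) (⊕-ᴱ x y)) ⟩
    (x ᴱ +ᵥ y ᴱ) ∙ (x ᶠ +ᵥ y ᶠ) xor ℓ ∙ (x ᴱ +ᵥ y ᴱ)
      ≡⟨ cong₂ _xor_ bilinear (∙-xorʳ ℓ (x ᴱ) (y ᴱ)) ⟩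
    ((x ᴱ ∙ x ᶠ xor x ᴱ ∙ y ᶠ) xor (x ᶠ ∙ y ᴱ xor y ᴱ ∙ y ᶠ)) xor (ℓ ∙ x ᴱ xor ℓ ∙ y ᴱ)
      ≡⟨ truth-table 6 (λ a b c d p q → ((a xor b) xor (c xor d)) xor (p xor q))
                       (λ a b c d p q → ((a xor p) xor (d xor q)) xor (b xor c)) _
                       (x ᴱ ∙ x ᶠ) (x ᴱ ∙ y ᶠ) (x ᶠ ∙ y ᴱ) (y ᴱ ∙ y ᶠ) (ℓ ∙ x ᴱ) (ℓ ∙ y ᴱ) ⟩
    (Qℓ ℓ x xor Qℓ ℓ y) xor (x ᴱ ∙ y ᶠ xor x ᶠ ∙ y ᴱ)
      ≡⟨ cong ((Qℓ ℓ x xor Qℓ ℓ y) xor_) (sym (⟪⟫-coordinates x y)) ⟩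
    (Qℓ ℓ x xor Qℓ ℓ y) xor ⟪ x , y ⟫ₘ
      ∎
    where
    bilinear : (x ᴱ +ᵥ y ᴱ) ∙ (x ᶠ +ᵥ y ᶠ) ≡ (x ᴱ ∙ x ᶠ xor x ᴱ ∙ y ᶠ) xor (x ᶠ ∙ y ᴱ xor y ᴱ ∙ y ᶠ)
    bilinear = trans (∙-xorˡ (x ᴱ) (y ᴱ) _) (cong₂ _xor_ (∙-xorʳ (x ᴱ) (x ᶠ) (y ᶠ))
      (trans (∙-xorʳ (y ᴱ) (x ᶠ) (y ᶠ)) (cong (_xor y ᴱ ∙ y ᶠ) (∙-comm (y ᴱ) (x ᶠ)))))

  -- Q_ℓ vanishes on every fᵢ, so every term of the Arf invariant vanishes
  Qℓ-Arf : ∀ ℓ → Arf {m} (Qℓ ℓ) ≡ false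
  Qℓ-Arf ℓ = ∑-zero (λ i → Qℓ ℓ (e i) ∧ Qℓ ℓ (f i)) λ i → trans (cong (Qℓ ℓ (e i) ∧_) (Qℓ-f i)) (∧-zeroʳ _)
    where
    Qℓ-f : ∀ i → Qℓ ℓ (f i) ≡ false
    Qℓ-f i = cong₂ _xor_ (trans (∙-cong (fᴱ-zero i) (λ _ → refl)) (∙-zeroˡ ((f i) ᶠ)))
                         (trans (∙-cong (λ _ → refl) (fᴱ-zero i)) (∙-zeroʳ ℓ))

  -- Q_ℓ is invariant under the shear by S when S ℓ = diag S: the shear adds
  -- (S x_F)·x_F + ℓ·(S x_F) = diag S·x_F + (S ℓ)·x_F = 0.
  Qℓ-shear-invariant : ∀ {S} ℓ → Symmetric S → (∀ i → (S *ᵥ ℓ) i ≡ diag S i) → ∀ x → Qℓ ℓ (shear S x) ≡ Qℓ ℓ x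
  Qℓ-shear-invariant {S} ℓ S-sym Sℓ≡diag x = begin
    Qℓ ℓ (shear S x)
      ≡⟨ cong₂ _xor_ (∙-cong (shear-ᴱ S x) (shear-ᶠ S x)) (∙-cong (λ _ → refl) (shear-ᴱ S x)) ⟩
    (x ᴱ +ᵥ S *ᵥ u) ∙ u xor ℓ ∙ (x ᴱ +ᵥ S *ᵥ u)
      ≡⟨ cong₂ _xor_ (∙-xorˡ (x ᴱ) _ u) (∙-xorʳ ℓ (x ᴱ) _) ⟩
    (x ᴱ ∙ u xor (S *ᵥ u) ∙ u) xor (ℓ ∙ x ᴱ xor ℓ ∙ (S *ᵥ u))
      ≡⟨ cong₂ (λ s t → (x ᴱ ∙ u xor s) xor (ℓ ∙ x ᴱ xor t)) (*ᵥ-diag S S-sym u) linear-term ⟩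
    (x ᴱ ∙ u xor diag S ∙ u) xor (ℓ ∙ x ᴱ xor diag S ∙ u)
      ≡⟨ xor-cancel-common (x ᴱ ∙ u) (ℓ ∙ x ᴱ) (diag S ∙ u) ⟩
    Qℓ ℓ x
      ∎
    where
    u = x ᶠ
    linear-term : ℓ ∙ (S *ᵥ u) ≡ diag S ∙ u
    linear-term = trans (sym (*ᵥ-adjoint S S-sym ℓ u)) (∙-cong Sℓ≡diag (λ _ → refl))

  -- A quadratic form invariant under the shear by S takes the value S_jj on
  -- the j-th column of S, read as an e-vector: apply invariance to fⱼ.
  column : Block m → Fin m → Fin m → Bool
  column S j i = S i j

  invariant-on-column : ∀ {Q S} → IsQuadratic {m} Q → (∀ x → Q (shear S x) ≡ Q x) →
                        ∀ j → Q (Eᵥ (column S j)) ≡ S j j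
  invariant-on-column {Q} {S} Q-quad Q-invariant j = xor-solve (Q φ) _ _ (begin
    Q φ                            ≡⟨ sym (Q-invariant φ) ⟩
    Q (shear S φ)                  ≡⟨ cong Q shear-φ ⟩
    Q (φ ⊕ w)                      ≡⟨ Q-quad φ w ⟩
    (Q φ xor Q w) xor ⟪ φ , w ⟫ₘ   ≡⟨ cong ((Q φ xor Q w) xor_) pairing ⟩
    (Q φ xor Q w) xor S j j        ∎)
    where
    φ = Fᵥ (δ j)
    w = Eᵥ (column S j)

    shear-φ : shear S φ ≡ φ ⊕ w
    shear-φ = trans (shear-as-sum S φ) (cong (φ ⊕_) (pair-cong {u' = column S j} {v' = 0ᵥ}
      (λ i → trans (*ᵥ-congʳ {S = S} (pair-ᶠ 0ᵥ (δ j)) i) (*ᵥ-δ S j i)) (λ _ → refl)))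

    pairing : ⟪ φ , w ⟫ₘ ≡ S j j
    pairing = trans (⟪⟫-coordinates φ w) (cong₂ _xor_
      (trans (∙-cong (pair-ᴱ 0ᵥ (δ j)) (pair-ᶠ (column S j) 0ᵥ)) (∙-zeroˡ {m} 0ᵥ))
      (trans (∙-cong (pair-ᶠ 0ᵥ (δ j)) (pair-ᴱ (column S j) 0ᵥ)) (∑-δ j (column S j))))

module KleinShears (n : ℕ) where

  m : ℕ
  m = suc (suc n)

  open Symplectic m

  K : Bool → Bool → Block m
  K a b zero       zero       = a xor b
  K a b zero       (suc zero) = b
  K a b (suc zero) zero       = b
  K a b (suc zero) (suc zero) = a
  K a b _          _          = false

  K-symmetric : ∀ a b → Symmetric (K a b)
  K-symmetric a b zero             zero             = refl
  K-symmetric a b zero             (suc zero)       = refl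
  K-symmetric a b zero             (suc (suc j))    = refl
  K-symmetric a b (suc zero)       zero             = refl
  K-symmetric a b (suc zero)       (suc zero)       = refl
  K-symmetric a b (suc zero)       (suc (suc j))    = refl
  K-symmetric a b (suc (suc i))    zero             = refl
  K-symmetric a b (suc (suc i))    (suc zero)       = refl
  K-symmetric a b (suc (suc i))    (suc (suc j))    = refl

  K-additive : ∀ a b a' b' i j → (K a b ⊞ K a' b') i j ≡ K (a xor a') (b xor b') i j
  K-additive a b a' b' zero          zero          = xor-interchange a b a' b'
  K-additive a b a' b' zero          (suc zero)    = refl
  K-additive a b a' b' zero          (suc (suc j)) = refl
  K-additive a b a' b' (suc zero)    zero          = refl
  K-additive a b a' b' (suc zero)    (suc zero)    = refl
  K-additive a b a' b' (suc zero)    (suc (suc j)) = refl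
  K-additive a b a' b' (suc (suc i)) zero          = refl
  K-additive a b a' b' (suc (suc i)) (suc zero)    = refl
  K-additive a b a' b' (suc (suc i)) (suc (suc j)) = refl

  -- W = {K a b}; membership is up to entrywise equality
  InKlein : Block m → Set
  InKlein S = Σ (Bool × Bool) λ c → ∀ i j → S i j ≡ K (proj₁ c) (proj₂ c) i j

  Klein-subspace : IsSymmetricSubspace InKlein
  Klein-subspace = record
    { symmetric = λ { ((a , b) , S≐K) i j → trans (S≐K i j) (trans (K-symmetric a b i j) (sym (S≐K j i))) }
      -- K 0 0 = K 0 0 + K 0 0 vanishes
    ; zero∈     = (false , false) , λ i j → trans (sym (xor-same (K false false i j))) (K-additive false false false false i j)
    ; ⊞-closed  = λ { ((a , b) , S≐K) ((a' , b') , S'≐K) → (a xor a' , b xor b') , λ i j →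
                      trans (cong₂ _xor_ (S≐K i j) (S'≐K i j)) (K-additive a b a' b' i j) }
    }

  G : Mat m → Set
  G = ShearGroup InKlein

  G-subgroup : IsSubgroupOfSp {m} G
  G-subgroup = ShearGroup-subgroup Klein-subspace

  -- the linear term ℓ = (a, a+b, 0, …) solves K a b ℓ = diag (K a b)
  ℓ : Bool → Bool → Fin m → Bool
  ℓ a b zero          = a
  ℓ a b (suc zero)    = a xor b
  ℓ a b (suc (suc _)) = false

  K-linear-term : ∀ a b i → (K a b *ᵥ ℓ a b) i ≡ diag (K a b) i
  K-linear-term a b i = trans (∙-supported₂ (K a b i) (ℓ a b) (λ _ → refl)) (row i)
    where
    row : ∀ i → K a b i zero ∧ a xor K a b i (suc zero) ∧ (a xor b) ≡ K a b i i
    row zero          = truth-table 2 (λ a b → (a xor b) ∧ a xor b ∧ (a xor b)) (λ a b → a xor b) _ a b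
    row (suc zero)    = truth-table 2 (λ a b → b ∧ a xor a ∧ (a xor b)) (λ a b → a) _ a b
    row (suc (suc i)) = refl

  each-element-fixes-a-form : ∀ g → G g →
    Σ (V m → Bool) λ Q → IsQuadratic {m} Q × Arf {m} Q ≡ false × Fixes {m} g Q
  each-element-fixes-a-form g (S , S∈W@((a , b) , S≐K) , gS) =
    Qℓ (ℓ a b) , Qℓ-quadratic (ℓ a b) , Qℓ-Arf (ℓ a b) ,
    IsShear-Fixes {Q = Qℓ (ℓ a b)} gS (Qℓ-shear-invariant (ℓ a b) S-sym Sℓ≡diag)
    where
    S-sym = IsSymmetricSubspace.symmetric Klein-subspace S∈W
    Sℓ≡diag : ∀ i → (S *ᵥ ℓ a b) i ≡ diag S i
    Sℓ≡diag i = trans (*ᵥ-congˡ {u = ℓ a b} S≐K i) (trans (K-linear-term a b i) (sym (S≐K i i)))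

  -- Invariance under
  -- K 1 0 = diag(1,1) gives Q(e₀) = Q(e₁) = 1, invariance under
  -- K 0 1 = [[1,1],[1,0]] gives Q(e₀ + e₁) = 1, but e₀ ⊥ e₁ forces
  -- Q(e₀ + e₁) = Q(e₀) + Q(e₁) = 0.
  no-fixed-form : ∀ Q → IsQuadratic {m} Q → ¬ (∀ g → G g → Fixes {m} g Q)
  no-fixed-form Q Q-quad fixed-by-G = true≢false (begin
    true                                      ≡⟨ sym (on-column false true zero) ⟩
    Q (Eᵥ (column (K false true) zero))       ≡⟨ cong Q e₀+e₁ ⟩
    Q (Eᵥ c₀ ⊕ Eᵥ c₁)                         ≡⟨ Q-quad (Eᵥ c₀) (Eᵥ c₁) ⟩
    (Q (Eᵥ c₀) xor Q (Eᵥ c₁)) xor ⟪ Eᵥ c₀ , Eᵥ c₁ ⟫ₘ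
      ≡⟨ cong₂ _xor_ (cong₂ _xor_ (on-column true false zero) (on-column true false (suc zero))) (⟪Eᵥ,Eᵥ⟫ c₀ c₁) ⟩
    false                                     ∎)
    where
    true≢false : true ≢ false
    true≢false ()

    on-column : ∀ a b j → Q (Eᵥ (column (K a b) j)) ≡ K a b j j
    on-column a b = invariant-on-column {Q} {K a b} Q-quad
      (Fixes-IsShear (shearMatrix-IsShear (K a b))
        (fixed-by-G (shearMatrix (K a b)) (K a b , ((a , b) , λ _ _ → refl) , shearMatrix-IsShear (K a b))))

    c₀ c₁ : Fin m → Bool
    c₀ = column (K true false) zero
    c₁ = column (K true false) (suc zero)

    e₀+e₁ : Eᵥ (column (K false true) zero) ≡ Eᵥ c₀ ⊕ Eᵥ c₁
    e₀+e₁ = trans (pair-cong {v' = 0ᵥ} sum-of-columns (λ _ → refl)) (Eᵥ-+ᵥ c₀ c₁)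
      where
      sum-of-columns : ∀ i → column (K false true) zero i ≡ (c₀ +ᵥ c₁) i
      sum-of-columns zero          = refl
      sum-of-columns (suc zero)    = refl
      sum-of-columns (suc (suc i)) = refl

lemma6p6 : (m : ℕ) → 3 ≤ m →
    Σ (Mat m → Set) λ G →
    IsSubgroupOfSp {m} G
    × (¬ (Σ (V m → Bool) λ Q →
    IsQuadratic {m} Q × Arf {m} Q ≡ false × (∀ g → G g → Fixes {m} g Q)))
    × (∀ g → G g → Σ (V m → Bool) λ Q →
    IsQuadratic {m} Q × Arf {m} Q ≡ false × Fixes {m} g Q)
lemma6p6 (suc (suc (suc k))) (s≤s (s≤s (s≤s z≤n))) =
  G ,
  G-subgroup ,
  (λ { (Q , Q-quad , _ , Q-fixed) → no-fixed-form Q Q-quad Q-fixed }) ,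
  each-element-fixes-a-form
  where open KleinShears (suc k)
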